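{- Let $k\ge1$ and $n\ge1$. The total number of descending $k$-Naples parking functions of length $n$ is $\binom{2n-1}{n}-\binom{2n-1}{n+k+1}$.
   Context: Parking rules: $n$ spots $1,\dots,n$; cars $c_1,\dots,c_n$ arrive in order with preferences $a_j\in[n]$; $k$-Naples rule: $c_j$ parks at $a_j$ if empty, otherwise checks spots $a_j-1,\dots,a_j-k$ (those $\ge1$) in order and parks in the first empty one, otherwise drives forward from $a_j$ and parks in the first empty spot after $a_j$ (failing if none). A preference is a $k$-Naples parking function if all cars park. Descending means weakly decreasing. $\binom{a}{b}=0$ if $b>a$. -}

module Defs where

open import Data.Bool using (Bool; true; false; not; _∧_; if_then_else_)
open import Data.Nat using (ℕ; zero; suc; _+_; _∸_; _≤ᵇ_; _<ᵇ_; _≡ᵇ_)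
open import Data.Bool.ListAction using (any)
open import Data.List using (List; []; _∷_; _++_; map; filterᵇ; upTo; length; concatMap)
open import Data.Maybe using (Maybe; just; nothing; is-just)

-- Spots and preferences are natural numbers; spots are 1,…,n.

occupied : List ℕ → ℕ → Bool
occupied O s = any (λ t → t ≡ᵇ s) O

firstFree : List ℕ → List ℕ → Maybe ℕ
firstFree O [] = nothing
firstFree O (s ∷ ss) = if occupied O s then firstFree O ss else just s

-- The ordered list of spots car with preference a checks under the k-Naples
-- rule with n spots:  a,  then a-1,…,a-k (only those ≥ 1),  then a+1,…,n.
naplesCandidates : ℕ → ℕ → ℕ → List ℕ
naplesCandidates k n a =
  a ∷ (map (λ i → a ∸ i) (filterᵇ (λ i → i <ᵇ a) (map suc (upTo k)))
       ++ map (λ i → a + suc i) (upTo (n ∸ a)))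

parkAll : ℕ → ℕ → List ℕ → List ℕ → Maybe (List ℕ)
parkAll k n O [] = just O
parkAll k n O (a ∷ as) with firstFree O (naplesCandidates k n a)
... | nothing = nothing
... | just s  = parkAll k n (s ∷ O) as

allPark : ℕ → ℕ → List ℕ → Bool
allPark k n prefs = is-just (parkAll k n [] prefs)

prefLists : ℕ → ℕ → List (List ℕ)
prefLists n zero = [] ∷ []
prefLists n (suc m) = concatMap (λ a → map (a ∷_) (prefLists n m)) (map suc (upTo n))

descending : List ℕ → Bool
descending [] = true
descending (a ∷ []) = true
descending (a ∷ b ∷ as) = (b ≤ᵇ a) ∧ descending (b ∷ as)

numDescNaples : ℕ → ℕ → ℕ
numDescNaples k n =
  length (filterᵇ (λ p → descending p ∧ allPark k n p) (prefLists n n))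

{-# OPTIONS --safe #-}
-- For a descending preference list, car i (counting from 0) with preference a searches every spot of
-- the window (a ∸ (k+1), n], and every earlier car, having a larger preference, parked inside its own
-- window, which is contained in this one. Hence the occupied spots always lie in the current window,
-- and car i parks iff that window still has a free spot, i.e. iff a ≤ k + (n ∸ i). Descending lists
-- obeying this staircase bound satisfy a ballot-type recursion, solved by C(m+d, m) − C(m+d, m+k+1)
-- through Pascal's rule.
module Submission where

open import Defs
open import Algebra.Bundles using (CommutativeMonoid)
open import Data.Bool using (Bool; true; false; _∧_; T; if_then_else_)
open import Data.Bool.Properties using (T-≡; T-∧; ∧-commutativeMonoid)
open import Data.Empty using (⊥-elim)
open import Data.List using (List; []; _∷_; _++_; map; filterᵇ; upTo; applyUpTo; length; concatMap)
open import Data.List.Membership.Propositional using (_∈_)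
open import Data.List.Membership.Propositional.Properties
  using (∈-map⁺; ∈-map⁻; ∈-++⁺ˡ; ∈-++⁺ʳ; ∈-++⁻; ∈-upTo⁺; ∈-upTo⁻; ∈-filter⁺; ∈-filter⁻)
open import Data.List.Properties using (filter-++; length-++; map-cong; map-∘)
open import Data.List.Relation.Unary.All using (All; []; _∷_; lookup)
import Data.List.Relation.Unary.All as All
import Data.List.Relation.Unary.All.Properties as All
open import Data.List.Relation.Unary.Any using (here; there)
open import Data.Maybe using (just; nothing; is-just)
open import Data.Nat
  using (ℕ; zero; suc; pred; _+_; _*_; _∸_; _≤_; _<_; _≥_; _≤ᵇ_; _<ᵇ_; _≡ᵇ_; z≤n; s≤s; s≤s⁻¹; z<s)
open import Data.Nat.Combinatorics using (_C_; k>n⇒nCk≡0; nCk≡nC[n∸k]; nCk+nC[k+1]≡[n+1]C[k+1])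
open import Data.Nat.ListAction using (sum)
open import Data.Nat.Properties
open import Data.Nat.Tactic.RingSolver using (solve-∀)
open import Data.Product using (_×_; _,_; proj₁; proj₂)
open import Data.Sum using (inj₁; inj₂)
open import Data.Unit using (tt)
open import Function using (_∘_; _⇔_; mk⇔; Equivalence)
open import Relation.Binary using (tri<; tri≈; tri>)
open import Relation.Binary.PropositionalEquality
open import Relation.Nullary using (¬_; yes; no)
open import Relation.Nullary.Decidable using (T?)

open import Algebra.Properties.CommutativeSemigroup
  (CommutativeMonoid.commutativeSemigroup ∧-commutativeMonoid) using (interchange)

T⇒≡true : ∀ {b} → T b → b ≡ true
T⇒≡true = Equivalence.to T-≡

¬T⇒≡false : ∀ {b} → ¬ T b → b ≡ false
¬T⇒≡false {false} _  = refl
¬T⇒≡false {true}  ¬t = ⊥-elim (¬t _)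

∸-suc<⇒≤+ : ∀ a k t → a ∸ suc k < t → a ≤ k + t
∸-suc<⇒≤+ a k t lt = begin
  a                     ≤⟨ m≤n+m∸n a (suc k) ⟩
  suc k + (a ∸ suc k)   ≡⟨ sym (+-suc k (a ∸ suc k)) ⟩
  k + suc (a ∸ suc k)   ≤⟨ +-monoʳ-≤ k lt ⟩
  k + t                 ∎
  where open ≤-Reasoning

countOccupied : List ℕ → ℕ → ℕ → ℕ
countOccupied O y zero    = 0
countOccupied O y (suc r) = (if occupied O (suc y) then 1 else 0) + countOccupied O (suc y) r

countOccupied-≤ : ∀ O y r → countOccupied O y r ≤ r
countOccupied-≤ O y zero = z≤n
countOccupied-≤ O y (suc r) with occupied O (suc y)
... | true  = s≤s (countOccupied-≤ O (suc y) r)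
... | false = m≤n⇒m≤1+n (countOccupied-≤ O (suc y) r)

countOccupied-[] : ∀ y r → countOccupied [] y r ≡ 0
countOccupied-[] y zero    = refl
countOccupied-[] y (suc r) = countOccupied-[] (suc y) r

countOccupied-full : ∀ O y r → (∀ {t} → y < t → t ≤ y + r → occupied O t ≡ true) →
                     countOccupied O y r ≡ r
countOccupied-full O y zero    full = refl
countOccupied-full O y (suc r) full
  rewrite +-suc y r | full ≤-refl (s≤s (m≤m+n y r)) =
  cong suc (countOccupied-full O (suc y) r (λ y<t t≤ → full (<⇒≤ y<t) t≤))

countOccupied-< : ∀ O y r {s} → occupied O s ≡ false → y < s → s ≤ y + r → countOccupied O y r < r
countOccupied-< O y zero {s} _ y<s s≤ = ⊥-elim (<⇒≱ y<s (subst (s ≤_) (+-identityʳ y) s≤))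
countOccupied-< O y (suc r) {s} free y<s s≤ with m≤n⇒m<n∨m≡n y<s
... | inj₂ refl rewrite free = s≤s (countOccupied-≤ O (suc y) r)
... | inj₁ y+1<s with occupied O (suc y)
...   | true  = s≤s (countOccupied-< O (suc y) r free y+1<s (subst (s ≤_) (+-suc y r) s≤))
...   | false = m<n⇒m<1+n (countOccupied-< O (suc y) r free y+1<s (subst (s ≤_) (+-suc y r) s≤))

countOccupied-∷-≤ : ∀ O y r {s} → s ≤ y → countOccupied (s ∷ O) y r ≡ countOccupied O y r
countOccupied-∷-≤ O y zero    s≤y = refl
countOccupied-∷-≤ O y (suc r) {s} s≤y
  rewrite ¬T⇒≡false {s ≡ᵇ suc y} (<⇒≢ (s≤s s≤y) ∘ ≡ᵇ⇒≡ s (suc y)) =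
  cong (_ +_) (countOccupied-∷-≤ O (suc y) r (m≤n⇒m≤1+n s≤y))

countOccupied-∷ : ∀ O y r {s} → occupied O s ≡ false → y < s → s ≤ y + r →
                  countOccupied (s ∷ O) y r ≡ suc (countOccupied O y r)
countOccupied-∷ O y zero {s} _ y<s s≤ = ⊥-elim (<⇒≱ y<s (subst (s ≤_) (+-identityʳ y) s≤))
countOccupied-∷ O y (suc r) {s} free y<s s≤ with m≤n⇒m<n∨m≡n y<s
... | inj₂ refl rewrite free | T⇒≡true (≡⇒≡ᵇ (suc y) (suc y) refl) =
  cong suc (countOccupied-∷-≤ O (suc y) r ≤-refl)
... | inj₁ y+1<s rewrite ¬T⇒≡false {s ≡ᵇ suc y} (<⇒≢ y+1<s ∘ sym ∘ ≡ᵇ⇒≡ s (suc y)) =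
  trans (cong (_ +_) (countOccupied-∷ O (suc y) r free y+1<s (subst (s ≤_) (+-suc y r) s≤)))
        (+-suc _ _)

firstFree≡nothing : ∀ O cs → firstFree O cs ≡ nothing → All (λ t → occupied O t ≡ true) cs
firstFree≡nothing O []       _  = []
firstFree≡nothing O (s ∷ ss) eq with occupied O s in occ
... | true = occ ∷ firstFree≡nothing O ss eq

firstFree≡just : ∀ O cs {s} → firstFree O cs ≡ just s → s ∈ cs × occupied O s ≡ false
firstFree≡just O (t ∷ ts) eq with occupied O t in occ
... | true  with s∈ , free ← firstFree≡just O ts eq = there s∈ , free
firstFree≡just O (t ∷ ts) refl | false = here refl , occ

module Candidates (k n : ℕ) where

  below above : ℕ → List ℕ
  below a = map (a ∸_) (filterᵇ (_<ᵇ a) (map suc (upTo k)))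
  above a = map (λ i → a + suc i) (upTo (n ∸ a))

  candidate⇒inWindow : ∀ {a s} → 1 ≤ a → a ≤ n → s ∈ naplesCandidates k n a → a ∸ suc k < s × s ≤ n
  candidate⇒inWindow {suc a} _ a≤n (here refl) = s≤s (m∸n≤m a k) , a≤n
  candidate⇒inWindow {a} _ a≤n (there s∈) with ∈-++⁻ (below a) s∈
  ... | inj₁ s∈below
    with i , i∈ , refl ← ∈-map⁻ (a ∸_) s∈below
    with i∈′ , i<a ← ∈-filter⁻ (T? ∘ (_<ᵇ a)) {xs = map suc (upTo k)} i∈
    with j , j<k , refl ← ∈-map⁻ suc {xs = upTo k} i∈′ =
      ≤-<-trans (∸-monoʳ-≤ a (s≤s (∈-upTo⁻ j<k))) (∸-monoʳ-< (n<1+n (suc j)) (<ᵇ⇒< _ a i<a))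
    , ≤-trans (m∸n≤m a (suc j)) a≤n
  ... | inj₂ s∈above
    with i , i<n∸a , refl ← ∈-map⁻ (λ i → a + suc i) s∈above =
      ≤-<-trans (m∸n≤m a (suc k)) (m<m+n a z<s)
    , ≤-trans (+-monoʳ-≤ a (∈-upTo⁻ i<n∸a)) (≤-reflexive (m+[n∸m]≡n a≤n))

  inWindow⇒candidate : ∀ {a t} → a ≤ n → a ∸ suc k < t → t ≤ n → t ∈ naplesCandidates k n a
  inWindow⇒candidate {a} {t} a≤n y<t t≤n with <-cmp t a
  ... | tri≈ _ refl _ = here refl
  ... | tri< t<a _ _ = there (∈-++⁺ˡ (subst (_∈ below a) (m∸[m∸n]≡n (<⇒≤ t<a))
          (∈-map⁺ (a ∸_) (∈-filter⁺ (T? ∘ (_<ᵇ a)) a∸t∈ (<⇒<ᵇ a∸t<a)))))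
    where
      a∸t<a : a ∸ t < a
      a∸t<a = ∸-monoʳ-< (≤-<-trans z≤n y<t) (<⇒≤ t<a)
      a∸t∈ : a ∸ t ∈ map suc (upTo k)
      a∸t∈ with a ∸ t in eq
      ... | zero  = ⊥-elim (m>n⇒m∸n≢0 t<a eq)
      ... | suc j = ∈-map⁺ suc (∈-upTo⁺ (≤-trans (≤-reflexive (sym eq))
                      (m≤n+o⇒m∸n≤o a t (subst (a ≤_) (+-comm k t) (∸-suc<⇒≤+ a k t y<t)))))
  ... | tri> _ _ a<t = there (∈-++⁺ʳ (below a)
          (subst (_∈ above a) a+[1+i]≡t (∈-map⁺ (λ i → a + suc i) (∈-upTo⁺ i<n∸a))))
    where
      i = t ∸ suc a
      a+[1+i]≡t : a + suc i ≡ t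
      a+[1+i]≡t = trans (+-suc a i) (m+[n∸m]≡n a<t)
      i<n∸a : i < n ∸ a
      i<n∸a = +-cancelˡ-< a i (n ∸ a) (begin-strict
        a + i         <⟨ +-monoʳ-< a (n<1+n i) ⟩
        a + suc i     ≡⟨ a+[1+i]≡t ⟩
        t             ≤⟨ t≤n ⟩
        n             ≡⟨ sym (m+[n∸m]≡n a≤n) ⟩
        a + (n ∸ a)   ∎)
        where open ≤-Reasoning

-- aᵢ ∸ (k+1) < r ∸ i for every i: the list has at most r entries and aᵢ ≤ k + (r ∸ i).
staircase : ℕ → ℕ → List ℕ → Bool
staircase k r []       = true
staircase k r (a ∷ as) = (a ∸ suc k <ᵇ r) ∧ staircase k (pred r) as

module Parking (k n : ℕ) where

  open Candidates k n

  InRange : ℕ → Set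
  InRange a = 1 ≤ a × a ≤ n

  -- Every occupied spot lies above b ∸ (k+1), and r spots are free.
  WindowInvariant : List ℕ → ℕ → ℕ → Set
  WindowInvariant O r b = ∀ y → y ≤ b ∸ suc k → countOccupied O y (n ∸ y) + r ≡ n

  private
    window≤n : ∀ {a} → a ≤ n → a ∸ suc k ≤ n
    window≤n {a} a≤n = ≤-trans (m∸n≤m a (suc k)) a≤n

  rejected⇒<ᵇ≡false : ∀ {O a r} → a ≤ n → firstFree O (naplesCandidates k n a) ≡ nothing →
                      countOccupied O (a ∸ suc k) (n ∸ (a ∸ suc k)) + r ≡ n → (a ∸ suc k <ᵇ r) ≡ false
  rejected⇒<ᵇ≡false {O} {a} {r} a≤n eq inv = ¬T⇒≡false (<-irrefl (sym r≡y) ∘ <ᵇ⇒< y r)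
    where
      y = a ∸ suc k
      full : countOccupied O y (n ∸ y) ≡ n ∸ y
      full = countOccupied-full O y (n ∸ y) λ {t} y<t t≤ →
        lookup (firstFree≡nothing O (naplesCandidates k n a) eq)
               (inWindow⇒candidate a≤n y<t (subst (t ≤_) (m+[n∸m]≡n (window≤n a≤n)) t≤))
      r≡y : r ≡ y
      r≡y = +-cancelˡ-≡ (n ∸ y) r y (begin
        n ∸ y + r                     ≡⟨ cong (_+ r) (sym full) ⟩
        countOccupied O y (n ∸ y) + r ≡⟨ inv ⟩
        n                             ≡⟨ sym (m∸n+n≡m (window≤n a≤n)) ⟩
        n ∸ y + y                     ∎)
        where open ≡-Reasoning

  module _ {O a s} (1≤a : 1 ≤ a) (a≤n : a ≤ n) (eq : firstFree O (naplesCandidates k n a) ≡ just s) where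

    private
      y = a ∸ suc k
      s∈ = proj₁ (firstFree≡just O (naplesCandidates k n a) eq)
      s-free = proj₂ (firstFree≡just O (naplesCandidates k n a) eq)
      y<s = proj₁ (candidate⇒inWindow 1≤a a≤n s∈)
      s≤n = proj₂ (candidate⇒inWindow 1≤a a≤n s∈)

      s≤x+[n∸x] : ∀ {x} → x ≤ n → s ≤ x + (n ∸ x)
      s≤x+[n∸x] x≤n = subst (s ≤_) (sym (m+[n∸m]≡n x≤n)) s≤n

    accepted⇒< : ∀ {r} → countOccupied O y (n ∸ y) + r ≡ n → y < r
    accepted⇒< {r} inv = +-cancelˡ-≤ c (suc y) r (begin
      c + suc y   ≡⟨ +-suc c y ⟩
      suc c + y   ≤⟨ m≤o∸n⇒m+n≤o (suc c) (window≤n a≤n) c<n∸y ⟩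
      n           ≡⟨ sym inv ⟩
      c + r       ∎)
      where
        open ≤-Reasoning
        c = countOccupied O y (n ∸ y)
        c<n∸y : c < n ∸ y
        c<n∸y = countOccupied-< O y (n ∸ y) s-free y<s (s≤x+[n∸x] (window≤n a≤n))

    WindowInvariant-park : ∀ {r b} → a ≤ b → y < r → WindowInvariant O r b → WindowInvariant (s ∷ O) (pred r) a
    WindowInvariant-park {suc r} a≤b _ inv x x≤y = begin
      countOccupied (s ∷ O) x (n ∸ x) + r  ≡⟨ cong (_+ r) (countOccupied-∷ O x (n ∸ x) s-free x<s (s≤x+[n∸x] x≤n)) ⟩
      suc (countOccupied O x (n ∸ x)) + r  ≡⟨ sym (+-suc _ r) ⟩
      countOccupied O x (n ∸ x) + suc r    ≡⟨ inv x (≤-trans x≤y (∸-monoˡ-≤ (suc k) a≤b)) ⟩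
      n                                    ∎
      where
        open ≡-Reasoning
        x<s = ≤-<-trans x≤y y<s
        x≤n = ≤-trans (<⇒≤ x<s) s≤n

  parkAll-descending : ∀ p O r b → T (descending (b ∷ p)) → All InRange p → WindowInvariant O r b →
                       is-just (parkAll k n O p) ≡ staircase k r p
  parkAll-descending []       O r b _    _                    _   = refl
  parkAll-descending (a ∷ as) O r b desc ((1≤a , a≤n) ∷ as∈) inv
    with a≤ᵇb , desc′ ← Equivalence.to T-∧ desc
    with a≤b ← ≤ᵇ⇒≤ a b a≤ᵇb
    with inv-a ← inv (a ∸ suc k) (∸-monoˡ-≤ (suc k) a≤b)
    with firstFree O (naplesCandidates k n a) in eq
  ... | nothing = sym (cong (_∧ staircase k (pred r) as) (rejected⇒<ᵇ≡false a≤n eq inv-a))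
  ... | just s  = begin
    is-just (parkAll k n (s ∷ O) as)            ≡⟨ parkAll-descending as (s ∷ O) (pred r) a desc′ as∈
                                                     (WindowInvariant-park 1≤a a≤n eq a≤b y<r inv) ⟩
    staircase k (pred r) as                     ≡⟨ cong (_∧ staircase k (pred r) as) (sym (T⇒≡true (<⇒<ᵇ y<r))) ⟩
    staircase k r (a ∷ as)                      ∎
    where
      open ≡-Reasoning
      y<r = accepted⇒< 1≤a a≤n eq inv-a

count : ∀ {A : Set} → (A → Bool) → List A → ℕ
count p xs = length (filterᵇ p xs)

module _ {A : Set} where

  count-++ : ∀ (p : A → Bool) xs ys → count p (xs ++ ys) ≡ count p xs + count p ys
  count-++ p xs ys = trans (cong length (filter-++ (T? ∘ p) xs ys)) (length-++ (filterᵇ p xs))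

  count-congᴬ : ∀ {p q : A → Bool} {xs} → All (λ x → p x ≡ q x) xs → count p xs ≡ count q xs
  count-congᴬ {p} {q} {[]}     []       = refl
  count-congᴬ {p} {q} {x ∷ xs} (e ∷ es) with p x | q x
  count-congᴬ (refl ∷ es) | true  | true  = cong suc (count-congᴬ es)
  count-congᴬ (refl ∷ es) | false | false = count-congᴬ es

  count-cong : ∀ {p q : A → Bool} → (∀ x → p x ≡ q x) → ∀ xs → count p xs ≡ count q xs
  count-cong p≗q xs = count-congᴬ (All.universal p≗q xs)

  count-∧ˡ : ∀ b (p : A → Bool) xs → count (λ x → b ∧ p x) xs ≡ (if b then count p xs else 0)
  count-∧ˡ true  p xs       = refl
  count-∧ˡ false p []       = refl
  count-∧ˡ false p (x ∷ xs) = count-∧ˡ false p xs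

  count-map : ∀ {B : Set} (p : B → Bool) (f : A → B) xs → count p (map f xs) ≡ count (p ∘ f) xs
  count-map p f []       = refl
  count-map p f (x ∷ xs) with p (f x)
  ... | true  = cong suc (count-map p f xs)
  ... | false = count-map p f xs

  count-concatMap : ∀ {B : Set} (p : A → Bool) (f : B → List A) xs →
                    count p (concatMap f xs) ≡ sum (map (count p ∘ f) xs)
  count-concatMap p f []       = refl
  count-concatMap p f (x ∷ xs) =
    trans (count-++ p (f x) (concatMap f xs)) (cong (count p (f x) +_) (count-concatMap p f xs))

sum< : (ℕ → ℕ) → ℕ → ℕ
sum< f zero    = 0
sum< f (suc e) = sum< f e + f e

sum<-suc : ∀ f e → sum< f (suc e) ≡ f 0 + sum< (f ∘ suc) e
sum<-suc f zero    = +-comm 0 (f 0)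
sum<-suc f (suc e) = trans (cong (_+ f (suc e)) (sum<-suc f e)) (+-assoc (f 0) _ _)

sum-map-applyUpTo : ∀ {A : Set} (g : A → ℕ) (f : ℕ → A) e → sum (map g (applyUpTo f e)) ≡ sum< (g ∘ f) e
sum-map-applyUpTo g f zero    = refl
sum-map-applyUpTo g f (suc e) =
  trans (cong (g (f 0) +_) (sum-map-applyUpTo g (f ∘ suc) e)) (sym (sum<-suc (g ∘ f) e))

sum<-cong : ∀ {f g} e → (∀ {i} → i < e → f i ≡ g i) → sum< f e ≡ sum< g e
sum<-cong zero    f≗g = refl
sum<-cong (suc e) f≗g = cong₂ _+_ (sum<-cong e (f≗g ∘ m<n⇒m<1+n)) (f≗g ≤-refl)

sum<-truncate : ∀ f {e n} → e ≤ n → (∀ {i} → e ≤ i → f i ≡ 0) → sum< f n ≡ sum< f e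
sum<-truncate f {e} {n} e≤n vanish = trans (cong (sum< f) (sym (m+[n∸m]≡n e≤n))) (go (n ∸ e))
  where
    go : ∀ r → sum< f (e + r) ≡ sum< f e
    go zero    = cong (sum< f) (+-identityʳ e)
    go (suc r) = begin
      sum< f (e + suc r)         ≡⟨ cong (sum< f) (+-suc e r) ⟩
      sum< f (e + r) + f (e + r) ≡⟨ cong₂ _+_ (go r) (vanish (m≤m+n e r)) ⟩
      sum< f e + 0               ≡⟨ +-identityʳ _ ⟩
      sum< f e                   ∎
      where open ≡-Reasoning

C-symmetric : ∀ a b → (a + b) C a ≡ (a + b) C b
C-symmetric a b = trans (nCk≡nC[n∸k] (m≤m+n a b)) (cong ((a + b) C_) (m+n∸m≡n a b))

[m+k+1]+m≡m+[1+m+k] : ∀ m k → m + k + 1 + m ≡ m + suc (m + k)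
[m+k+1]+m≡m+[1+m+k] = solve-∀

module Counting (k n : ℕ) where

  staircaseCount : ℕ → ℕ → ℕ
  staircaseCount m c = count (λ p → descending (c ∷ p) ∧ staircase k m p) (prefLists n m)

  admissible : ℕ → ℕ → ℕ → Bool
  admissible m c a = (a ≤ᵇ c) ∧ (a ∸ suc k <ᵇ suc m)

  staircaseCount-suc : ∀ m c →
    staircaseCount (suc m) c ≡ sum< (λ i → if admissible m c (suc i) then staircaseCount m (suc i) else 0) n
  staircaseCount-suc m c = begin
    count P (concatMap (λ a → map (a ∷_) (prefLists n m)) (map suc (upTo n)))
      ≡⟨ count-concatMap P _ (map suc (upTo n)) ⟩
    sum (map (λ a → count P (map (a ∷_) (prefLists n m))) (map suc (upTo n)))
      ≡⟨ cong sum (map-cong prepend (map suc (upTo n))) ⟩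
    sum (map g (map suc (upTo n)))
      ≡⟨ cong sum (sym (map-∘ (upTo n))) ⟩
    sum (map (g ∘ suc) (upTo n))
      ≡⟨ sum-map-applyUpTo (g ∘ suc) (λ i → i) n ⟩
    sum< (g ∘ suc) n ∎
    where
      open ≡-Reasoning
      P : List ℕ → Bool
      P p = descending (c ∷ p) ∧ staircase k (suc m) p
      g : ℕ → ℕ
      g a = if admissible m c a then staircaseCount m a else 0
      prepend : ∀ a → count P (map (a ∷_) (prefLists n m)) ≡ g a
      prepend a = begin
        count P (map (a ∷_) (prefLists n m))
          ≡⟨ count-map P (a ∷_) (prefLists n m) ⟩
        count (P ∘ (a ∷_)) (prefLists n m)
          ≡⟨ count-cong (λ p → interchange (a ≤ᵇ c) (descending (a ∷ p)) (a ∸ suc k <ᵇ suc m) (staircase k m p))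
                        (prefLists n m) ⟩
        count (λ p → admissible m c a ∧ (descending (a ∷ p) ∧ staircase k m p)) (prefLists n m)
          ≡⟨ count-∧ˡ (admissible m c a) (λ p → descending (a ∷ p) ∧ staircase k m p) (prefLists n m) ⟩
        g a ∎

  admissible-suc⇔ : ∀ m c i → T (admissible m c (suc i)) ⇔ (i < c × i ≤ m + k)
  admissible-suc⇔ m c i = mk⇔
    (λ adm → let i<c , i∸k<1+m = Equivalence.to T-∧ adm in
      ≤ᵇ⇒≤ (suc i) c i<c ,
      ≤-trans (m≤n+m∸n i k) (≤-trans (+-monoʳ-≤ k (s≤s⁻¹ (<ᵇ⇒< _ _ i∸k<1+m))) (≤-reflexive (+-comm k m))))
    (λ (i<c , i≤m+k) → Equivalence.from T-∧
      (≤⇒≤ᵇ i<c , <⇒<ᵇ (s≤s (m≤n+o⇒m∸n≤o i k (subst (i ≤_) (+-comm m k) i≤m+k)))))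

  staircaseCount-suc-sum< : ∀ m c e → e ≤ n → (∀ {i} → i < e ⇔ (i < c × i ≤ m + k)) →
                            staircaseCount (suc m) c ≡ sum< (staircaseCount m ∘ suc) e
  staircaseCount-suc-sum< m c e e≤n range = begin
    staircaseCount (suc m) c   ≡⟨ staircaseCount-suc m c ⟩
    sum< f n                   ≡⟨ sum<-truncate f e≤n outside ⟩
    sum< f e                   ≡⟨ sum<-cong e inside ⟩
    sum< (staircaseCount m ∘ suc) e ∎
    where
      open ≡-Reasoning
      f : ℕ → ℕ
      f i = if admissible m c (suc i) then staircaseCount m (suc i) else 0
      inside : ∀ {i} → i < e → f i ≡ staircaseCount m (suc i)
      inside {i} i<e
        rewrite T⇒≡true (Equivalence.from (admissible-suc⇔ m c i) (Equivalence.to range i<e)) = refl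
      outside : ∀ {i} → e ≤ i → f i ≡ 0
      outside {i} e≤i
        rewrite ¬T⇒≡false ((λ i<e → <⇒≱ i<e e≤i) ∘ Equivalence.from range ∘ Equivalence.to (admissible-suc⇔ m c i))
        = refl

  Closed : ℕ → Set
  Closed m = ∀ d → d < n → d ≤ m + k → staircaseCount m (suc d) + (m + d) C (m + k + 1) ≡ (m + d) C m

  -- Summing the closed form over d < e, both binomial columns telescope by Pascal's rule.
  sum<-staircaseCount : ∀ m → Closed m → ∀ e → e ≤ n → e ≤ suc (m + k) →
    sum< (staircaseCount m ∘ suc) e + (m + e) C suc (m + k + 1) ≡ (m + e) C suc m
  sum<-staircaseCount m closed zero _ _
    rewrite +-identityʳ m
          | k>n⇒nCk≡0 {m} {suc (m + k + 1)} (s≤s (≤-trans (m≤m+n m k) (m≤m+n (m + k) 1)))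
          | k>n⇒nCk≡0 {m} {suc m} ≤-refl = refl
  sum<-staircaseCount m closed (suc e) e<n e≤
    rewrite +-suc m e
          | sym (nCk+nC[k+1]≡[n+1]C[k+1] (m + e) (m + k + 1))
          | sym (nCk+nC[k+1]≡[n+1]C[k+1] (m + e) m) = begin
    (S + N) + (B + B′)         ≡⟨ shuffle S N B B′ ⟩
    (S + B′) + (N + B)         ≡⟨ cong₂ _+_ (sum<-staircaseCount m closed e (<⇒≤ e<n) (<⇒≤ e≤))
                                            (closed e e<n (s≤s⁻¹ e≤)) ⟩
    (m + e) C suc m + (m + e) C m ≡⟨ +-comm ((m + e) C suc m) ((m + e) C m) ⟩
    (m + e) C m + (m + e) C suc m ∎
    where
      open ≡-Reasoning
      S = sum< (staircaseCount m ∘ suc) e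
      N = staircaseCount m (suc e)
      B = (m + e) C (m + k + 1)
      B′ = (m + e) C suc (m + k + 1)
      shuffle : ∀ a b c d → (a + b) + (c + d) ≡ (a + d) + (b + c)
      shuffle = solve-∀

  staircaseCount-closed : ∀ m → Closed m
  staircaseCount-closed zero d _ d≤k
    rewrite k>n⇒nCk≡0 {d} {k + 1} (≤-trans (s≤s d≤k) (≤-reflexive (+-comm 1 k))) = refl
  staircaseCount-closed (suc m) d d<n d≤ with d ≤? m + k
  ... | yes d≤m+k = begin
    staircaseCount (suc m) (suc d) + suc (m + d) C suc (m + k + 1)
      ≡⟨ cong (_+ _) (staircaseCount-suc-sum< m (suc d) (suc d) d<n
                        (mk⇔ (λ i<1+d → i<1+d , ≤-trans (s≤s⁻¹ i<1+d) d≤m+k) proj₁)) ⟩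
    sum< (staircaseCount m ∘ suc) (suc d) + suc (m + d) C suc (m + k + 1)
      ≡⟨ subst (λ x → sum< (staircaseCount m ∘ suc) (suc d) + x C suc (m + k + 1) ≡ x C suc m) (+-suc m d)
               (sum<-staircaseCount m (staircaseCount-closed m) (suc d) d<n (s≤s d≤m+k)) ⟩
    suc (m + d) C suc m ∎
    where open ≡-Reasoning
  -- For d = m + k + 1 the staircase, not c, caps the sum; the missing term comes back by symmetry.
  ... | no d≰m+k with refl ← ≤-antisym d≤ (≰⇒> d≰m+k) = begin
    staircaseCount (suc m) (suc d) + suc (m + d) C suc (m + k + 1)
      ≡⟨ cong (_+ _) (staircaseCount-suc-sum< m (suc d) d (<⇒≤ d<n)
                        (mk⇔ (λ i<d → m<n⇒m<1+n i<d , s≤s⁻¹ i<d) (s≤s ∘ proj₂))) ⟩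
    S + suc (m + d) C suc (m + k + 1)
      ≡⟨ cong (S +_) (sym (nCk+nC[k+1]≡[n+1]C[k+1] (m + d) (m + k + 1))) ⟩
    S + ((m + d) C (m + k + 1) + (m + d) C suc (m + k + 1))
      ≡⟨ shuffle S ((m + d) C (m + k + 1)) ((m + d) C suc (m + k + 1)) ⟩
    (m + d) C (m + k + 1) + (S + (m + d) C suc (m + k + 1))
      ≡⟨ cong₂ _+_ symmetric (sum<-staircaseCount m (staircaseCount-closed m) d (<⇒≤ d<n) ≤-refl) ⟩
    (m + d) C m + (m + d) C suc m
      ≡⟨ nCk+nC[k+1]≡[n+1]C[k+1] (m + d) m ⟩
    suc (m + d) C suc m ∎
    where
      open ≡-Reasoning
      S = sum< (staircaseCount m ∘ suc) d
      shuffle : ∀ a b c → a + (b + c) ≡ b + (a + c)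
      shuffle = solve-∀
      symmetric : (m + d) C (m + k + 1) ≡ (m + d) C m
      symmetric = subst (λ x → x C (m + k + 1) ≡ x C m) ([m+k+1]+m≡m+[1+m+k] m k)
                        (C-symmetric (m + k + 1) m)

module _ (k n : ℕ) where

  open Parking k n
  open Counting k n

  prefLists-InRange : ∀ m → All (All InRange) (prefLists n m)
  prefLists-InRange zero    = [] ∷ []
  prefLists-InRange (suc m) = All.concat⁺ (All.map⁺ (All.map⁺ (All.applyUpTo⁺₁ (λ i → i) n λ i<n →
    All.map⁺ (All.map ((s≤s z≤n , i<n) ∷_) (prefLists-InRange m)))))

  descending-∷-n : ∀ {p} → All InRange p → descending (n ∷ p) ≡ descending p
  descending-∷-n []                    = refl
  descending-∷-n {a ∷ _} ((_ , a≤n) ∷ _) rewrite T⇒≡true (≤⇒≤ᵇ a≤n) = refl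

  descending∧allPark≡staircase : ∀ p → All InRange p →
    descending p ∧ allPark k n p ≡ descending (n ∷ p) ∧ staircase k n p
  descending∧allPark≡staircase p p∈ rewrite descending-∷-n p∈ with descending p in desc
  ... | false = refl
  ... | true  = parkAll-descending p [] n n (subst T (sym (trans (descending-∷-n p∈) desc)) tt) p∈
                  (λ y _ → cong (_+ n) (countOccupied-[] y (n ∸ y)))

  numDescNaples≡staircaseCount : numDescNaples k n ≡ staircaseCount n n
  numDescNaples≡staircaseCount =
    count-congᴬ (All.map (λ {p} → descending∧allPark≡staircase p) (prefLists-InRange n))

corollary5p11 : (k n : ℕ) → k ≥ 1 → n ≥ 1 →
    numDescNaples k n ≡ ((2 * n ∸ 1) C n) ∸ ((2 * n ∸ 1) C (n + k + 1))
corollary5p11 k n@(suc n′) _ _ = begin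
  numDescNaples k n           ≡⟨ numDescNaples≡staircaseCount k n ⟩
  staircaseCount n n          ≡⟨ sym (m+n∸n≡m (staircaseCount n n) B) ⟩
  staircaseCount n n + B ∸ B  ≡⟨ cong (_∸ B) closed ⟩
  (2 * n ∸ 1) C n ∸ B         ∎
  where
    open ≡-Reasoning
    open Counting k n
    B = (2 * n ∸ 1) C (n + k + 1)
    2n∸1≡n+n′ : 2 * n ∸ 1 ≡ n + n′
    2n∸1≡n+n′ = trans (+-suc n′ (n′ + 0)) (cong (suc ∘ (n′ +_)) (+-identityʳ n′))
    closed : staircaseCount n n + B ≡ (2 * n ∸ 1) C n
    closed rewrite 2n∸1≡n+n′ = staircaseCount-closed n n′ ≤-refl (≤-trans (n≤1+n n′) (m≤m+n n k))
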